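{- For every integer $h\ge 0$, as polynomials in $t$, $$Z(L_h;\{\mathrm{tr}_1,\mathrm{hd}\},\{\mathrm{tr}_2\};t,1)=Z(L_h;\{\mathrm{tr}_2,\mathrm{hd}\},\{\mathrm{tr}_1\};t,1)=Z(L_h;\{\mathrm{tr}_1\},\{\mathrm{tr}_2,\mathrm{hd}\};t,1)=Z(L_h;\{\mathrm{tr}_2\},\{\mathrm{tr}_1,\mathrm{hd}\};t,1)=t\,(t^2+t)^h.$$
   Context: For a simple graph $G$ and disjoint $B,C\subseteq V(G)$, $Z(G;B,C;t,y)=\sum_{S:\,B\subseteq S\subseteq V(G)\setminus C} t^{|E_G(S)|+|E_G(\bar S)|}y^{|S|}$, where $\bar S=V(G)\setminus S$ and $E_G(S)$ (resp. $E_G(\bar S)$) is the set of edges with both endpoints in $S$ (resp. $\bar S$). For $h\ge 0$, the graph $L_h$ is obtained from a path $P_{h+1}$ with $h+1$ vertices and $h$ edges, one endpoint of which is called $\mathrm{hd}$, by adding two new vertices $\mathrm{tr}_1,\mathrm{tr}_2$ and making each of them adjacent to all vertices of $P_{h+1}$ (and not to each other). -}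

module Defs where

open import Data.Nat using (ℕ; zero; suc; _+_; _*_; _^_; _≡ᵇ_; _≤ᵇ_; _<ᵇ_)
open import Data.Bool using (Bool; true; false; _∧_; _∨_; not; if_then_else_)
open import Data.List using (List; []; _∷_; _++_; map; foldr; concatMap; replicate)
open import Data.Bool.ListAction using (any; all)
open import Data.Vec using (Vec; lookup; tabulate)
  renaming ([] to []ᵥ; _∷_ to _∷ᵥ_)
open import Data.Fin using (Fin; toℕ)
open import Data.List using (allFin)
open import Data.Product using (_×_; _,_)
open import Relation.Binary.PropositionalEquality using (_≡_)

-- Polynomials in one variable t with natural-number coefficients,
-- represented as coefficient lists (index i = coefficient of t^i).

Poly : Set
Poly = List ℕ

_+ₚ_ : Poly → Poly → Poly
[] +ₚ q = q
(a ∷ p) +ₚ [] = a ∷ p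
(a ∷ p) +ₚ (b ∷ q) = (a + b) ∷ (p +ₚ q)

scaleₚ : ℕ → Poly → Poly
scaleₚ c = map (c *_)

_*ₚ_ : Poly → Poly → Poly
[] *ₚ q = []
(a ∷ p) *ₚ q = scaleₚ a q +ₚ (0 ∷ (p *ₚ q))

oneₚ : Poly
oneₚ = 1 ∷ []

tₚ : Poly
tₚ = 0 ∷ 1 ∷ []

_^ₚ_ : Poly → ℕ → Poly
p ^ₚ zero = oneₚ
p ^ₚ suc n = p *ₚ (p ^ₚ n)

monomial : ℕ → ℕ → Poly
monomial c e = replicate e 0 ++ (c ∷ [])

coeff : Poly → ℕ → ℕ
coeff [] k = 0
coeff (a ∷ p) zero = a
coeff (a ∷ p) (suc k) = coeff p k

-- equality as polynomials (coefficientwise; trailing zeros irrelevant)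
_≈ₚ_ : Poly → Poly → Set
p ≈ₚ q = ∀ k → coeff p k ≡ coeff q k

infixl 6 _+ₚ_
infixl 7 _*ₚ_
infixr 8 _^ₚ_
infix 4 _≈ₚ_

-- Simple graphs on vertex set Fin n, given by a (symmetric, irreflexive)
-- Boolean adjacency function; vertex subsets are Boolean vectors.

Graph : ℕ → Set
Graph n = Fin n → Fin n → Bool

VSet : ℕ → Set
VSet n = Vec Bool n

-- unordered pairs {i,j} of distinct vertices, listed as (i,j) with i < j
pairs : (n : ℕ) → List (Fin n × Fin n)
pairs n = concatMap (λ i → concatMap (λ j → if toℕ i <ᵇ toℕ j then (i , j) ∷ [] else [])
                                          (allFin n))
                    (allFin n)

count : {A : Set} → (A → Bool) → List A → ℕ
count P [] = 0
count P (x ∷ xs) = (if P x then 1 else 0) + count P xs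

edgesIn : {n : ℕ} → Graph n → VSet n → ℕ
edgesIn {n} G S = count (λ { (i , j) → G i j ∧ lookup S i ∧ lookup S j }) (pairs n)

edgesOut : {n : ℕ} → Graph n → VSet n → ℕ
edgesOut {n} G S = count (λ { (i , j) → G i j ∧ not (lookup S i) ∧ not (lookup S j) }) (pairs n)

size : {n : ℕ} → VSet n → ℕ
size {n} S = count (lookup S) (allFin n)

allSubsets : (n : ℕ) → List (VSet n)
allSubsets zero = []ᵥ ∷ []
allSubsets (suc n) = map (true ∷ᵥ_) (allSubsets n) ++ map (false ∷ᵥ_) (allSubsets n)

admissible : {n : ℕ} → VSet n → VSet n → VSet n → Bool
admissible {n} B C S =
  all (λ i → (not (lookup B i) ∨ lookup S i) ∧ (not (lookup C i) ∨ not (lookup S i))) (allFin n)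

-- Z(G;B,C;t,y) for a natural number y, as a polynomial in t
Z : {n : ℕ} → Graph n → VSet n → VSet n → ℕ → Poly
Z {n} G B C y =
  foldr _+ₚ_ []
    (map (λ S → if admissible B C S
                  then monomial (y ^ size S) (edgesIn G S + edgesOut G S)
                  else [])
         (allSubsets n))

-- The graph L_h on vertex set Fin (h + 3):
--   vertices 0,…,h form the path P_{h+1} (edges {a, a+1}), hd = 0,
--   tr₁ = h+1, tr₂ = h+2, each tr adjacent to all path vertices.

adjℕ : ℕ → ℕ → ℕ → Bool
adjℕ h a b = pathE a b ∨ pathE b a ∨ trE a b ∨ trE b a
  where
  pathE : ℕ → ℕ → Bool
  pathE x y = (suc x ≡ᵇ y) ∧ (y ≤ᵇ h)
  trE : ℕ → ℕ → Bool
  trE x y = (x ≤ᵇ h) ∧ ((y ≡ᵇ suc h) ∨ (y ≡ᵇ suc (suc h)))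

L : (h : ℕ) → Graph (h + 3)
L h i j = adjℕ h (toℕ i) (toℕ j)

hd tr₁ tr₂ : ℕ → ℕ
hd h = 0
tr₁ h = suc h
tr₂ h = suc (suc h)

vset : (n : ℕ) → List ℕ → VSet n
vset n xs = tabulate (λ i → any (λ x → toℕ i ≡ᵇ x) xs)

rhs : ℕ → Poly
rhs h = tₚ *ₚ ((tₚ *ₚ tₚ +ₚ tₚ) ^ₚ h)

module Submission where

open import Defs
open import Data.Nat using (ℕ; zero; suc; _+_; _*_; _^_; _≡ᵇ_; _≤ᵇ_; _<ᵇ_; _≤_; _<_; s≤s; z<s)
open import Data.Nat.Properties
open import Algebra.Bundles using (CommutativeMonoid)
open import Algebra.Properties.CommutativeSemigroup +-commutativeSemigroup using (interchange)
open import Data.Bool using (Bool; true; false; _∧_; _∨_; not; if_then_else_)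
open import Data.Bool.Properties
  using (∧-zeroʳ; ∧-identityʳ; ∨-zeroʳ; ∨-identityʳ; ∧-conicalʳ; T-≡; ∧-commutativeMonoid)
open import Algebra.Properties.CommutativeSemigroup (CommutativeMonoid.commutativeSemigroup ∧-commutativeMonoid)
  using () renaming (interchange to ∧-interchange)
open import Data.Bool.Solver using (module ∨-∧-Solver)
open import Data.Bool.ListAction using (any; all)
open import Data.List using (List; []; _∷_; _++_; map; foldr; concatMap; tabulate; allFin)
open import Data.List.Relation.Unary.All using (All; []; _∷_)
open import Data.Vec using (lookup) renaming ([] to []ᵥ; _∷_ to _∷ᵥ_)
open import Data.Vec.Properties using (lookup∘tabulate)
open import Data.Fin using (Fin; toℕ) renaming (zero to fz; suc to fs)
open import Data.Product using (_×_; _,_)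
open import Function using (_∘_; Equivalence)
open import Relation.Binary.PropositionalEquality
open ≡-Reasoning

-- Colour the vertices by membership in S.  The boundary conditions give tr₁ and tr₂
-- opposite colours, so every path vertex has exactly one monochromatic edge to
-- {tr₁, tr₂}: these contribute t^(h+1) to every admissible S.  The remaining
-- monochromatic edges lie on the path, and summing t^(#monochromatic path edges) over
-- the colourings of the path with the colour of hd fixed gives (1 + t)^h: deleting hd
-- leaves the same sum for a path one shorter, once with the same and once with the
-- opposite colour at its end.  Hence Z = t^(h+1) (1 + t)^h = t (t² + t)^h.  We compare
-- coefficient sequences, keeping the factor t^h with the path sum so that it satisfies
-- the recursion of (t² + t)^h.

-- Booleans as indicators

⟨_⟩ : Bool → ℕ
⟨ b ⟩ = if b then 1 else 0

_==_ : Bool → Bool → Bool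
x == true  = x
x == false = not x

⟨∧⟩ : ∀ x y → ⟨ x ∧ y ⟩ ≡ ⟨ x ⟩ * ⟨ y ⟩
⟨∧⟩ true  true  = refl
⟨∧⟩ true  false = refl
⟨∧⟩ false y     = refl

⟨==⟩+⟨==not⟩ : ∀ x y → ⟨ x == y ⟩ + ⟨ x == not y ⟩ ≡ 1
⟨==⟩+⟨==not⟩ true  true  = refl
⟨==⟩+⟨==not⟩ true  false = refl
⟨==⟩+⟨==not⟩ false true  = refl
⟨==⟩+⟨==not⟩ false false = refl

⟨both⟩+⟨neither⟩ : ∀ c d x y →
  ⟨ c ∧ (d ∧ (x ∧ y)) ⟩ + ⟨ c ∧ (d ∧ (not x ∧ not y)) ⟩ ≡ ⟨ c ∧ d ⟩ * ⟨ x == y ⟩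
⟨both⟩+⟨neither⟩ false d     x     y     = refl
⟨both⟩+⟨neither⟩ true  false x     y     = refl
⟨both⟩+⟨neither⟩ true  true  true  true  = refl
⟨both⟩+⟨neither⟩ true  true  true  false = refl
⟨both⟩+⟨neither⟩ true  true  false true  = refl
⟨both⟩+⟨neither⟩ true  true  false false = refl

not-∨-∨ : ∀ u v p → (not (u ∨ v) ∨ p) ≡ (not u ∨ p) ∧ (not v ∨ p)
not-∨-∨ false v p     = refl
not-∨-∨ true  v false = refl
not-∨-∨ true  v true  = sym (∨-zeroʳ (not v))

<ᵇ-true : ∀ {m n} → m < n → (m <ᵇ n) ≡ true
<ᵇ-true m<n = Equivalence.to T-≡ (<⇒<ᵇ m<n)

<ᵇ-suc : ∀ a h → (a <ᵇ suc h) ≡ (a ≤ᵇ h)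
<ᵇ-suc zero    h = refl
<ᵇ-suc (suc a) h = refl

<ᵇ-2+-∧-<ᵇ : ∀ a h → ((a <ᵇ suc (suc h)) ∧ (a <ᵇ h)) ≡ (a <ᵇ h)
<ᵇ-2+-∧-<ᵇ a       zero    = ∧-zeroʳ _
<ᵇ-2+-∧-<ᵇ zero    (suc h) = refl
<ᵇ-2+-∧-<ᵇ (suc a) (suc h) = <ᵇ-2+-∧-<ᵇ a h

-- Finite sums

private variable A A′ : Set

∑ₗ : (A → ℕ) → List A → ℕ
∑ₗ f []       = 0
∑ₗ f (x ∷ xs) = f x + ∑ₗ f xs

∑ₗ-cong : {f g : A → ℕ} (xs : List A) → (∀ x → f x ≡ g x) → ∑ₗ f xs ≡ ∑ₗ g xs
∑ₗ-cong []       f≗g = refl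
∑ₗ-cong (x ∷ xs) f≗g = cong₂ _+_ (f≗g x) (∑ₗ-cong xs f≗g)

∑ₗ-zero : (xs : List A) → ∑ₗ (λ _ → 0) xs ≡ 0
∑ₗ-zero []       = refl
∑ₗ-zero (x ∷ xs) = ∑ₗ-zero xs

∑ₗ-+ : (f g : A → ℕ) (xs : List A) → ∑ₗ (λ x → f x + g x) xs ≡ ∑ₗ f xs + ∑ₗ g xs
∑ₗ-+ f g []       = refl
∑ₗ-+ f g (x ∷ xs) =
  trans (cong (f x + g x +_) (∑ₗ-+ f g xs)) (interchange (f x) (g x) (∑ₗ f xs) (∑ₗ g xs))

∑ₗ-++ : (f : A → ℕ) (xs ys : List A) → ∑ₗ f (xs ++ ys) ≡ ∑ₗ f xs + ∑ₗ f ys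
∑ₗ-++ f []       ys = refl
∑ₗ-++ f (x ∷ xs) ys = trans (cong (f x +_) (∑ₗ-++ f xs ys)) (sym (+-assoc (f x) _ _))

∑ₗ-map : (f : A′ → ℕ) (g : A → A′) (xs : List A) → ∑ₗ f (map g xs) ≡ ∑ₗ (f ∘ g) xs
∑ₗ-map f g []       = refl
∑ₗ-map f g (x ∷ xs) = cong (f (g x) +_) (∑ₗ-map f g xs)

∑ₗ-concatMap : (f : A′ → ℕ) (g : A → List A′) (xs : List A) →
  ∑ₗ f (concatMap g xs) ≡ ∑ₗ (∑ₗ f ∘ g) xs
∑ₗ-concatMap f g []       = refl
∑ₗ-concatMap f g (x ∷ xs) =
  trans (∑ₗ-++ f (g x) (concatMap g xs)) (cong (∑ₗ f (g x) +_) (∑ₗ-concatMap f g xs))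

∑ₗ-singleton-if : (f : A → ℕ) (c : Bool) (x : A) →
  ∑ₗ f (if c then x ∷ [] else []) ≡ (if c then f x else 0)
∑ₗ-singleton-if f true  x = +-identityʳ (f x)
∑ₗ-singleton-if f false x = refl

count≡∑ₗ : (P : A → Bool) (xs : List A) → count P xs ≡ ∑ₗ (λ x → ⟨ P x ⟩) xs
count≡∑ₗ P []       = refl
count≡∑ₗ P (x ∷ xs) = cong (⟨ P x ⟩ +_) (count≡∑ₗ P xs)

∑ : ℕ → (ℕ → ℕ) → ℕ
∑ zero    f = 0
∑ (suc n) f = f 0 + ∑ n (f ∘ suc)

∑-cong : ∀ n {f g : ℕ → ℕ} → (∀ a → f a ≡ g a) → ∑ n f ≡ ∑ n g
∑-cong zero    f≗g = refl
∑-cong (suc n) f≗g = cong₂ _+_ (f≗g 0) (∑-cong n (f≗g ∘ suc))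

∑-+ : ∀ n (f g : ℕ → ℕ) → ∑ n (λ a → f a + g a) ≡ ∑ n f + ∑ n g
∑-+ zero    f g = refl
∑-+ (suc n) f g =
  trans (cong (f 0 + g 0 +_) (∑-+ n (f ∘ suc) (g ∘ suc))) (interchange (f 0) (g 0) _ _)

∑-*ˡ : ∀ n c (f : ℕ → ℕ) → ∑ n (λ a → c * f a) ≡ c * ∑ n f
∑-*ˡ zero    c f = sym (*-zeroʳ c)
∑-*ˡ (suc n) c f = trans (cong (c * f 0 +_) (∑-*ˡ n c (f ∘ suc))) (sym (*-distribˡ-+ c (f 0) _))

∑-zero : ∀ n → ∑ n (λ _ → 0) ≡ 0
∑-zero zero    = refl
∑-zero (suc n) = ∑-zero n

∑-one : ∀ n → ∑ n (λ _ → 1) ≡ n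
∑-one zero    = refl
∑-one (suc n) = cong suc (∑-one n)

∑-point : ∀ n c (g : ℕ → ℕ) → ∑ n (λ b → ⟨ c ≡ᵇ b ⟩ * g b) ≡ ⟨ c <ᵇ n ⟩ * g c
∑-point zero    c       g = refl
∑-point (suc n) zero    g = trans (cong (g 0 + 0 +_) (∑-zero n)) (+-identityʳ _)
∑-point (suc n) (suc c) g = ∑-point n c (g ∘ suc)

∑-<ᵇ : ∀ {m n} (f : ℕ → ℕ) → m ≤ n → ∑ n (λ a → ⟨ a <ᵇ m ⟩ * f a) ≡ ∑ m f
∑-<ᵇ {zero}  {n}     f m≤n       = ∑-zero n
∑-<ᵇ {suc m} {suc n} f (s≤s m≤n) = cong₂ _+_ (+-identityʳ (f 0)) (∑-<ᵇ (f ∘ suc) m≤n)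

∑ₗ-tabulate : ∀ n {A : Set} (ι : Fin n → A) (g : A → ℕ) (F : ℕ → ℕ) →
  (∀ i → g (ι i) ≡ F (toℕ i)) → ∑ₗ g (tabulate ι) ≡ ∑ n F
∑ₗ-tabulate zero    ι g F eq = refl
∑ₗ-tabulate (suc n) ι g F eq =
  cong₂ _+_ (eq fz) (∑ₗ-tabulate n (ι ∘ fs) g (F ∘ suc) (eq ∘ fs))

-- Coefficient sequences

shift : (ℕ → ℕ) → ℕ → ℕ
shift f zero    = 0
shift f (suc k) = f k

δ : ℕ → ℕ → ℕ
δ e k = ⟨ e ≡ᵇ k ⟩

shift-cong : ∀ {f g} k → (∀ j → f j ≡ g j) → shift f k ≡ shift g k
shift-cong zero    f≗g = refl
shift-cong (suc k) f≗g = f≗g k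

shift-zero : ∀ {f} k → (∀ j → f j ≡ 0) → shift f k ≡ 0
shift-zero zero    f≗0 = refl
shift-zero (suc k) f≗0 = f≗0 k

shift-+ : ∀ f g k → shift (λ j → f j + g j) k ≡ shift f k + shift g k
shift-+ f g zero    = refl
shift-+ f g (suc k) = refl

c*δ-suc : ∀ c e k → c * δ (suc e) k ≡ shift (λ j → c * δ e j) k
c*δ-suc c e zero    = *-zeroʳ c
c*δ-suc c e (suc k) = refl

∑ₗ-shift : (F : A → ℕ → ℕ) (xs : List A) (k : ℕ) →
  ∑ₗ (λ x → shift (F x) k) xs ≡ shift (λ j → ∑ₗ (λ x → F x j) xs) k
∑ₗ-shift F xs zero    = ∑ₗ-zero xs
∑ₗ-shift F xs (suc k) = refl

coeff-+ₚ : ∀ p q k → coeff (p +ₚ q) k ≡ coeff p k + coeff q k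
coeff-+ₚ []      q       k       = refl
coeff-+ₚ (a ∷ p) []      k       = sym (+-identityʳ _)
coeff-+ₚ (a ∷ p) (b ∷ q) zero    = refl
coeff-+ₚ (a ∷ p) (b ∷ q) (suc k) = coeff-+ₚ p q k

coeff-scaleₚ : ∀ c p k → coeff (scaleₚ c p) k ≡ c * coeff p k
coeff-scaleₚ c []      k       = sym (*-zeroʳ c)
coeff-scaleₚ c (a ∷ p) zero    = refl
coeff-scaleₚ c (a ∷ p) (suc k) = coeff-scaleₚ c p k

coeff-∷*ₚ : ∀ a p q k → coeff ((a ∷ p) *ₚ q) k ≡ a * coeff q k + shift (coeff (p *ₚ q)) k
coeff-∷*ₚ a p q k = trans (coeff-+ₚ (scaleₚ a q) _ k) (cong₂ _+_ (coeff-scaleₚ a q k) (lemma k))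
  where
  lemma : ∀ k → coeff (0 ∷ (p *ₚ q)) k ≡ shift (coeff (p *ₚ q)) k
  lemma zero    = refl
  lemma (suc k) = refl

coeff-oneₚ*ₚ : ∀ q k → coeff (oneₚ *ₚ q) k ≡ coeff q k
coeff-oneₚ*ₚ q k = begin
  coeff (oneₚ *ₚ q) k                ≡⟨ coeff-∷*ₚ 1 [] q k ⟩
  1 * coeff q k + shift (coeff []) k ≡⟨ cong₂ _+_ (*-identityˡ _) (shift-zero k (λ _ → refl)) ⟩
  coeff q k + 0                      ≡⟨ +-identityʳ _ ⟩
  coeff q k                          ∎

coeff-tₚ*ₚ : ∀ q k → coeff (tₚ *ₚ q) k ≡ shift (coeff q) k
coeff-tₚ*ₚ q k = trans (coeff-∷*ₚ 0 oneₚ q k) (shift-cong k (coeff-oneₚ*ₚ q))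

coeff-[t²+t]*ₚ : ∀ q k →
  coeff ((tₚ *ₚ tₚ +ₚ tₚ) *ₚ q) k ≡ shift (shift (coeff q)) k + shift (coeff q) k
coeff-[t²+t]*ₚ q k = begin
  coeff ((0 ∷ 1 ∷ 1 ∷ []) *ₚ q) k                  ≡⟨ coeff-∷*ₚ 0 (1 ∷ 1 ∷ []) q k ⟩
  shift (coeff ((1 ∷ 1 ∷ []) *ₚ q)) k              ≡⟨ shift-cong k step ⟩
  shift (λ j → coeff q j + shift (coeff q) j) k    ≡⟨ shift-+ (coeff q) (shift (coeff q)) k ⟩
  shift (coeff q) k + shift (shift (coeff q)) k    ≡⟨ +-comm (shift (coeff q) k) _ ⟩
  shift (shift (coeff q)) k + shift (coeff q) k    ∎
  where
  step : ∀ j → coeff ((1 ∷ 1 ∷ []) *ₚ q) j ≡ coeff q j + shift (coeff q) j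
  step j = trans (coeff-∷*ₚ 1 oneₚ q j)
                 (cong₂ _+_ (*-identityˡ _) (shift-cong j (coeff-oneₚ*ₚ q)))

coeff-foldr-+ₚ : (F : A → Poly) (xs : List A) (k : ℕ) →
  coeff (foldr _+ₚ_ [] (map F xs)) k ≡ ∑ₗ (λ x → coeff (F x) k) xs
coeff-foldr-+ₚ F []       k = refl
coeff-foldr-+ₚ F (x ∷ xs) k =
  trans (coeff-+ₚ (F x) _ k) (cong (coeff (F x) k +_) (coeff-foldr-+ₚ F xs k))

coeff-monomial : ∀ c e k → coeff (monomial c e) k ≡ c * δ e k
coeff-monomial c zero    zero    = sym (*-identityʳ c)
coeff-monomial c zero    (suc k) = sym (*-zeroʳ c)
coeff-monomial c (suc e) zero    = sym (*-zeroʳ c)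
coeff-monomial c (suc e) (suc k) = coeff-monomial c e k

-- Monochromatic edges

-- S read as a colouring of ℕ (false outside Fin n)
⟦_⟧ : ∀ {n} → VSet n → ℕ → Bool
⟦ []ᵥ     ⟧ a       = false
⟦ x ∷ᵥ S ⟧ zero    = x
⟦ x ∷ᵥ S ⟧ (suc a) = ⟦ S ⟧ a

lookup≡⟦⟧ : ∀ {n} (S : VSet n) (i : Fin n) → lookup S i ≡ ⟦ S ⟧ (toℕ i)
lookup≡⟦⟧ (x ∷ᵥ S) fz     = refl
lookup≡⟦⟧ (x ∷ᵥ S) (fs i) = lookup≡⟦⟧ S i

graphOn : (n : ℕ) → (ℕ → ℕ → Bool) → Graph n
graphOn n R i j = R (toℕ i) (toℕ j)

count-pairs : ∀ n (P : Fin n × Fin n → Bool) (R : ℕ → ℕ → Bool) →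
  (∀ i j → P (i , j) ≡ R (toℕ i) (toℕ j)) →
  count P (pairs n) ≡ ∑ n (λ a → ∑ n (λ b → ⟨ (a <ᵇ b) ∧ R a b ⟩))
count-pairs n P R P≗R =
  trans (count≡∑ₗ P (pairs n))
  (trans (∑ₗ-concatMap ⟨P⟩ _ (allFin n))
  (∑ₗ-tabulate n (λ i → i) _ _ λ i →
     trans (∑ₗ-concatMap ⟨P⟩ _ (allFin n))
     (∑ₗ-tabulate n (λ j → j) _ _ λ j →
       trans (∑ₗ-singleton-if ⟨P⟩ (toℕ i <ᵇ toℕ j) (i , j)) (if-⟨⟩ (toℕ i <ᵇ toℕ j) (P≗R i j)))))
  where
  ⟨P⟩ : Fin n × Fin n → ℕ
  ⟨P⟩ e = ⟨ P e ⟩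
  if-⟨⟩ : ∀ {x y} c → x ≡ y → (if c then ⟨ x ⟩ else 0) ≡ ⟨ c ∧ y ⟩
  if-⟨⟩ true  refl = refl
  if-⟨⟩ false _    = refl

monochromatic-edges : ∀ n (R : ℕ → ℕ → Bool) (S : VSet n) →
  edgesIn (graphOn n R) S + edgesOut (graphOn n R) S
    ≡ ∑ n (λ a → ∑ n (λ b → ⟨ (a <ᵇ b) ∧ R a b ⟩ * ⟨ ⟦ S ⟧ a == ⟦ S ⟧ b ⟩))
monochromatic-edges n R S = begin
    edgesIn (graphOn n R) S + edgesOut (graphOn n R) S
  ≡⟨ cong₂ _+_
       (count-pairs n (λ { (i , j) → graphOn n R i j ∧ lookup S i ∧ lookup S j })
          (λ a b → R a b ∧ (σ a ∧ σ b))
          (λ i j → cong (R (toℕ i) (toℕ j) ∧_) (cong₂ _∧_ (lookup≡⟦⟧ S i) (lookup≡⟦⟧ S j))))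
       (count-pairs n (λ { (i , j) → graphOn n R i j ∧ not (lookup S i) ∧ not (lookup S j) })
          (λ a b → R a b ∧ (not (σ a) ∧ not (σ b)))
          (λ i j → cong (R (toℕ i) (toℕ j) ∧_)
                        (cong₂ (λ x y → not x ∧ not y) (lookup≡⟦⟧ S i) (lookup≡⟦⟧ S j)))) ⟩
    ∑ n (λ a → ∑ n (both a)) + ∑ n (λ a → ∑ n (neither a))
  ≡⟨ sym (∑-+ n _ _) ⟩
    ∑ n (λ a → ∑ n (both a) + ∑ n (neither a))
  ≡⟨ ∑-cong n (λ a → trans (sym (∑-+ n (both a) (neither a)))
                           (∑-cong n (λ b → ⟨both⟩+⟨neither⟩ (a <ᵇ b) (R a b) (σ a) (σ b)))) ⟩
    ∑ n (λ a → ∑ n (λ b → ⟨ (a <ᵇ b) ∧ R a b ⟩ * ⟨ σ a == σ b ⟩)) ∎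
  where
  σ : ℕ → Bool
  σ = ⟦ S ⟧
  both neither : ℕ → ℕ → ℕ
  both    a b = ⟨ (a <ᵇ b) ∧ (R a b ∧ (σ a ∧ σ b)) ⟩
  neither a b = ⟨ (a <ᵇ b) ∧ (R a b ∧ (not (σ a) ∧ not (σ b))) ⟩

-- The graph L_h

L-upper-edge : ∀ a b h → ⟨ (a <ᵇ b) ∧ adjℕ h a b ⟩
  ≡ ⟨ (suc a ≡ᵇ b) ∧ (b ≤ᵇ h) ⟩ + ⟨ (a ≤ᵇ h) ∧ ((b ≡ᵇ suc h) ∨ (b ≡ᵇ suc (suc h))) ⟩
L-upper-edge a zero h rewrite ∧-zeroʳ (a ≤ᵇ h) = refl
L-upper-edge zero (suc zero) zero    = refl
L-upper-edge zero (suc zero) (suc h) = refl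
L-upper-edge zero (suc (suc b)) h
  rewrite ∧-zeroʳ (suc b <ᵇ h) | ∨-identityʳ ((suc b ≡ᵇ h) ∨ (suc b ≡ᵇ suc h)) = refl
L-upper-edge (suc a) (suc b) zero
  rewrite ∧-zeroʳ (suc a ≡ᵇ b) | ∧-zeroʳ (suc b ≡ᵇ a) = ⟨∧false⟩ (a <ᵇ b)
  where
  ⟨∧false⟩ : ∀ c → ⟨ c ∧ false ⟩ ≡ 0
  ⟨∧false⟩ true  = refl
  ⟨∧false⟩ false = refl
L-upper-edge (suc a) (suc b) (suc h) rewrite <ᵇ-suc a h | <ᵇ-suc b h = L-upper-edge a b h

⟨≡ᵇ∨≡ᵇsuc⟩ : ∀ b c → ⟨ (b ≡ᵇ c) ∨ (b ≡ᵇ suc c) ⟩ ≡ ⟨ c ≡ᵇ b ⟩ + ⟨ suc c ≡ᵇ b ⟩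
⟨≡ᵇ∨≡ᵇsuc⟩ zero          zero    = refl
⟨≡ᵇ∨≡ᵇsuc⟩ zero          (suc c) = refl
⟨≡ᵇ∨≡ᵇsuc⟩ (suc zero)    zero    = refl
⟨≡ᵇ∨≡ᵇsuc⟩ (suc (suc b)) zero    = refl
⟨≡ᵇ∨≡ᵇsuc⟩ (suc b)       (suc c) = ⟨≡ᵇ∨≡ᵇsuc⟩ b c

L-upper-neighbours : ∀ h a (g : ℕ → ℕ) →
  ∑ (3 + h) (λ b → ⟨ (a <ᵇ b) ∧ adjℕ h a b ⟩ * g b)
    ≡ ⟨ a <ᵇ h ⟩ * g (suc a) + ⟨ a ≤ᵇ h ⟩ * (g (suc h) + g (suc (suc h)))
L-upper-neighbours h a g = begin
    ∑ N (λ b → ⟨ (a <ᵇ b) ∧ adjℕ h a b ⟩ * g b)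
  ≡⟨ ∑-cong N (λ b → trans (cong (_* g b) (L-upper-edge a b h))
                           (*-distribʳ-+ (g b) ⟨ pathEdge b ⟩ ⟨ (a ≤ᵇ h) ∧ trEdge b ⟩)) ⟩
    ∑ N (λ b → ⟨ pathEdge b ⟩ * g b + ⟨ (a ≤ᵇ h) ∧ trEdge b ⟩ * g b)
  ≡⟨ ∑-+ N (λ b → ⟨ pathEdge b ⟩ * g b) (λ b → ⟨ (a ≤ᵇ h) ∧ trEdge b ⟩ * g b) ⟩
    ∑ N (λ b → ⟨ pathEdge b ⟩ * g b) + ∑ N (λ b → ⟨ (a ≤ᵇ h) ∧ trEdge b ⟩ * g b)
  ≡⟨ cong₂ _+_ path (trans (∑-cong N (λ b → trans (cong (_* g b) (⟨∧⟩ (a ≤ᵇ h) (trEdge b)))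
                                                       (*-assoc ⟨ a ≤ᵇ h ⟩ ⟨ trEdge b ⟩ (g b))))
                           (trans (∑-*ˡ N ⟨ a ≤ᵇ h ⟩ (λ b → ⟨ trEdge b ⟩ * g b))
                                  (cong (⟨ a ≤ᵇ h ⟩ *_) tr))) ⟩
    ⟨ a <ᵇ h ⟩ * g (suc a) + ⟨ a ≤ᵇ h ⟩ * (g (suc h) + g (suc (suc h))) ∎
  where
  N = 3 + h
  pathEdge trEdge : ℕ → Bool
  pathEdge b = (suc a ≡ᵇ b) ∧ (b ≤ᵇ h)
  trEdge   b = (b ≡ᵇ suc h) ∨ (b ≡ᵇ suc (suc h))

  path : ∑ N (λ b → ⟨ pathEdge b ⟩ * g b) ≡ ⟨ a <ᵇ h ⟩ * g (suc a)
  path = begin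
      ∑ N (λ b → ⟨ pathEdge b ⟩ * g b)
    ≡⟨ ∑-cong N (λ b → trans (cong (_* g b) (⟨∧⟩ (suc a ≡ᵇ b) (b ≤ᵇ h))) (*-assoc ⟨ suc a ≡ᵇ b ⟩ ⟨ b ≤ᵇ h ⟩ (g b))) ⟩
      ∑ N (λ b → ⟨ suc a ≡ᵇ b ⟩ * (⟨ b ≤ᵇ h ⟩ * g b))
    ≡⟨ ∑-point N (suc a) (λ b → ⟨ b ≤ᵇ h ⟩ * g b) ⟩
      ⟨ a <ᵇ suc (suc h) ⟩ * (⟨ a <ᵇ h ⟩ * g (suc a))
    ≡⟨ sym (*-assoc ⟨ a <ᵇ suc (suc h) ⟩ ⟨ a <ᵇ h ⟩ (g (suc a))) ⟩
      ⟨ a <ᵇ suc (suc h) ⟩ * ⟨ a <ᵇ h ⟩ * g (suc a)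
    ≡⟨ cong (_* g (suc a)) (trans (sym (⟨∧⟩ (a <ᵇ suc (suc h)) (a <ᵇ h))) (cong ⟨_⟩ (<ᵇ-2+-∧-<ᵇ a h))) ⟩
      ⟨ a <ᵇ h ⟩ * g (suc a) ∎

  tr : ∑ N (λ b → ⟨ trEdge b ⟩ * g b) ≡ g (suc h) + g (suc (suc h))
  tr = begin
      ∑ N (λ b → ⟨ trEdge b ⟩ * g b)
    ≡⟨ ∑-cong N (λ b → trans (cong (_* g b) (⟨≡ᵇ∨≡ᵇsuc⟩ b (suc h))) (*-distribʳ-+ (g b) ⟨ suc h ≡ᵇ b ⟩ ⟨ suc (suc h) ≡ᵇ b ⟩)) ⟩
      ∑ N (λ b → ⟨ suc h ≡ᵇ b ⟩ * g b + ⟨ suc (suc h) ≡ᵇ b ⟩ * g b)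
    ≡⟨ ∑-+ N (λ b → ⟨ suc h ≡ᵇ b ⟩ * g b) (λ b → ⟨ suc (suc h) ≡ᵇ b ⟩ * g b) ⟩
      ∑ N (λ b → ⟨ suc h ≡ᵇ b ⟩ * g b) + ∑ N (λ b → ⟨ suc (suc h) ≡ᵇ b ⟩ * g b)
    ≡⟨ cong₂ _+_ (∑-point N (suc h) g) (∑-point N (suc (suc h)) g) ⟩
      ⟨ suc h <ᵇ N ⟩ * g (suc h) + ⟨ suc (suc h) <ᵇ N ⟩ * g (suc (suc h))
    ≡⟨ cong₂ (λ x y → ⟨ x ⟩ * g (suc h) + ⟨ y ⟩ * g (suc (suc h)))
             (<ᵇ-true (m<n+m (suc h) {2} z<s)) (<ᵇ-true (n<1+n (suc (suc h)))) ⟩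
      1 * g (suc h) + 1 * g (suc (suc h))
    ≡⟨ cong₂ _+_ (*-identityˡ (g (suc h))) (*-identityˡ (g (suc (suc h)))) ⟩
      g (suc h) + g (suc (suc h)) ∎

monoPathEdges : ℕ → (ℕ → Bool) → ℕ
monoPathEdges h σ = ∑ h (λ a → ⟨ σ a == σ (suc a) ⟩)

L-monochromatic-edges : ∀ h (S : VSet (3 + h)) → ⟦ S ⟧ (2 + h) ≡ not (⟦ S ⟧ (1 + h)) →
  edgesIn (graphOn (3 + h) (adjℕ h)) S + edgesOut (graphOn (3 + h) (adjℕ h)) S
    ≡ suc h + monoPathEdges h ⟦ S ⟧
L-monochromatic-edges h S tr₂-opposite = begin
    edgesIn (graphOn N (adjℕ h)) S + edgesOut (graphOn N (adjℕ h)) S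
  ≡⟨ monochromatic-edges N (adjℕ h) S ⟩
    ∑ N (λ a → ∑ N (λ b → ⟨ (a <ᵇ b) ∧ adjℕ h a b ⟩ * ⟨ σ a == σ b ⟩))
  ≡⟨ ∑-cong N (λ a → L-upper-neighbours h a (λ b → ⟨ σ a == σ b ⟩)) ⟩
    ∑ N (λ a → path a + ⟨ a ≤ᵇ h ⟩ * (⟨ σ a == σ (suc h) ⟩ + ⟨ σ a == σ (suc (suc h)) ⟩))
  ≡⟨ ∑-cong N (λ a → cong₂ (λ c m → path a + ⟨ c ⟩ * m) (sym (<ᵇ-suc a h)) (one-tr-edge a)) ⟩
    ∑ N (λ a → path a + ⟨ a <ᵇ suc h ⟩ * 1)
  ≡⟨ ∑-+ N path (λ a → ⟨ a <ᵇ suc h ⟩ * 1) ⟩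
    ∑ N path + ∑ N (λ a → ⟨ a <ᵇ suc h ⟩ * 1)
  ≡⟨ cong₂ _+_ (∑-<ᵇ (λ a → ⟨ σ a == σ (suc a) ⟩) (m≤n+m h 3))
               (trans (∑-<ᵇ (λ _ → 1) (m≤n+m (suc h) 2)) (∑-one (suc h))) ⟩
    monoPathEdges h σ + suc h
  ≡⟨ +-comm (monoPathEdges h σ) (suc h) ⟩
    suc h + monoPathEdges h σ ∎
  where
  N = 3 + h
  σ = ⟦ S ⟧
  path : ℕ → ℕ
  path a = ⟨ a <ᵇ h ⟩ * ⟨ σ a == σ (suc a) ⟩
  one-tr-edge : ∀ a → ⟨ σ a == σ (suc h) ⟩ + ⟨ σ a == σ (suc (suc h)) ⟩ ≡ 1
  one-tr-edge a = trans (cong (λ z → ⟨ σ a == σ (suc h) ⟩ + ⟨ σ a == z ⟩) tr₂-opposite)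
                        (⟨==⟩+⟨==not⟩ (σ a) (σ (suc h)))

-- Boundary conditions

allBelow : ℕ → (ℕ → Bool) → Bool
allBelow zero    P = true
allBelow (suc n) P = P 0 ∧ allBelow n (P ∘ suc)

allBelow-cong : ∀ n {P Q : ℕ → Bool} → (∀ a → P a ≡ Q a) → allBelow n P ≡ allBelow n Q
allBelow-cong zero    P≗Q = refl
allBelow-cong (suc n) P≗Q = cong₂ _∧_ (P≗Q 0) (allBelow-cong n (P≗Q ∘ suc))

allBelow-true : ∀ n → allBelow n (λ _ → true) ≡ true
allBelow-true zero    = refl
allBelow-true (suc n) = allBelow-true n

allBelow-∧ : ∀ n (P Q : ℕ → Bool) → allBelow n (λ a → P a ∧ Q a) ≡ allBelow n P ∧ allBelow n Q
allBelow-∧ zero    P Q = refl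
allBelow-∧ (suc n) P Q =
  trans (cong ((P 0 ∧ Q 0) ∧_) (allBelow-∧ n (P ∘ suc) (Q ∘ suc))) (∧-interchange (P 0) (Q 0) _ _)

allBelow-point : ∀ n c (P : ℕ → Bool) → allBelow n (λ a → not (a ≡ᵇ c) ∨ P a) ≡ not (c <ᵇ n) ∨ P c
allBelow-point zero    c       P = refl
allBelow-point (suc n) zero    P = trans (cong (P 0 ∧_) (allBelow-true n)) (∧-identityʳ (P 0))
allBelow-point (suc n) (suc c) P = allBelow-point n c (P ∘ suc)

allBelow-∉ : ∀ n xs (P : ℕ → Bool) →
  allBelow n (λ a → not (any (λ x → a ≡ᵇ x) xs) ∨ P a) ≡ all (λ x → not (x <ᵇ n) ∨ P x) xs
allBelow-∉ n []       P = allBelow-true n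
allBelow-∉ n (x ∷ xs) P =
  trans (allBelow-cong n (λ a → not-∨-∨ (a ≡ᵇ x) (any (λ x → a ≡ᵇ x) xs) (P a)))
  (trans (allBelow-∧ n _ _) (cong₂ _∧_ (allBelow-point n x P) (allBelow-∉ n xs P)))

all-bounded : ∀ {n} {xs} (P : ℕ → Bool) → All (_< n) xs →
  all (λ x → not (x <ᵇ n) ∨ P x) xs ≡ all P xs
all-bounded P []                                 = refl
all-bounded P (_∷_ {x} x<n xs<n) rewrite <ᵇ-true x<n = cong (P x ∧_) (all-bounded P xs<n)

all-tabulate : ∀ n (ι : Fin n → A) (Q : A → Bool) (P : ℕ → Bool) →
  (∀ i → Q (ι i) ≡ P (toℕ i)) → all Q (tabulate ι) ≡ allBelow n P
all-tabulate zero    ι Q P Q≗P = refl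
all-tabulate (suc n) ι Q P Q≗P = cong₂ _∧_ (Q≗P fz) (all-tabulate n (ι ∘ fs) Q (P ∘ suc) (Q≗P ∘ fs))

admissible-vset : ∀ {n} xs ys (S : VSet n) → All (_< n) xs → All (_< n) ys →
  admissible (vset n xs) (vset n ys) S ≡ all ⟦ S ⟧ xs ∧ all (not ∘ ⟦ S ⟧) ys
admissible-vset {n} xs ys S xs<n ys<n =
  trans (all-tabulate n (λ i → i) _ (λ a → inB a ∧ outC a) clause)
  (trans (allBelow-∧ n inB outC)
  (cong₂ _∧_ (trans (allBelow-∉ n xs ⟦ S ⟧) (all-bounded ⟦ S ⟧ xs<n))
             (trans (allBelow-∉ n ys (not ∘ ⟦ S ⟧)) (all-bounded (not ∘ ⟦ S ⟧) ys<n))))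
  where
  inB outC : ℕ → Bool
  inB  a = not (any (λ x → a ≡ᵇ x) xs) ∨ ⟦ S ⟧ a
  outC a = not (any (λ y → a ≡ᵇ y) ys) ∨ not (⟦ S ⟧ a)
  clause : ∀ i → (not (lookup (vset n xs) i) ∨ lookup S i) ∧ (not (lookup (vset n ys) i) ∨ not (lookup S i))
               ≡ inB (toℕ i) ∧ outC (toℕ i)
  clause i rewrite lookup∘tabulate (λ j → any (λ x → toℕ j ≡ᵇ x) xs) i
                 | lookup∘tabulate (λ j → any (λ y → toℕ j ≡ᵇ y) ys) i
                 | lookup≡⟦⟧ S i = refl

trColoured : ℕ → Bool → (ℕ → Bool) → Bool
trColoured h γ σ = (σ (suc h) == γ) ∧ (σ (suc (suc h)) == not γ)

pinned : ℕ → Bool → Bool → (ℕ → Bool) → Bool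
pinned h β γ σ = (σ 0 == β) ∧ trColoured h γ σ

trColoured-opposite : ∀ γ y z → ((y == γ) ∧ (z == not γ)) ≡ true → z ≡ not y
trColoured-opposite true  true  false _ = refl
trColoured-opposite false false true  _ = refl
trColoured-opposite true  false _     ()
trColoured-opposite true  true  true  ()
trColoured-opposite false true  _     ()
trColoured-opposite false false false ()

module _ (h : ℕ) (S : VSet (3 + h)) where
  open ∨-∧-Solver using (solve; _:*_; _:=_; con)

  private
    σ = ⟦ S ⟧
    hd< : 0 < 3 + h
    hd< = z<s
    tr₁< : 1 + h < 3 + h
    tr₁< = m<n+m (suc h) {2} z<s
    tr₂< : 2 + h < 3 + h
    tr₂< = n<1+n (2 + h)

  admissible-[tr₁,hd]-[tr₂] :
    admissible (vset (3 + h) (tr₁ h ∷ hd h ∷ [])) (vset (3 + h) (tr₂ h ∷ [])) S ≡ pinned h true true σ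
  admissible-[tr₁,hd]-[tr₂] = trans (admissible-vset _ _ S (tr₁< ∷ hd< ∷ []) (tr₂< ∷ []))
    (solve 3 (λ x y z → (y :* (x :* con true)) :* (z :* con true) := x :* (y :* z)) refl
           (σ 0) (σ (1 + h)) (not (σ (2 + h))))

  admissible-[tr₂,hd]-[tr₁] :
    admissible (vset (3 + h) (tr₂ h ∷ hd h ∷ [])) (vset (3 + h) (tr₁ h ∷ [])) S ≡ pinned h true false σ
  admissible-[tr₂,hd]-[tr₁] = trans (admissible-vset _ _ S (tr₂< ∷ hd< ∷ []) (tr₁< ∷ []))
    (solve 3 (λ x y z → (z :* (x :* con true)) :* (y :* con true) := x :* (y :* z)) refl
           (σ 0) (not (σ (1 + h))) (σ (2 + h)))

  admissible-[tr₁]-[tr₂,hd] :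
    admissible (vset (3 + h) (tr₁ h ∷ [])) (vset (3 + h) (tr₂ h ∷ hd h ∷ [])) S ≡ pinned h false true σ
  admissible-[tr₁]-[tr₂,hd] = trans (admissible-vset _ _ S (tr₁< ∷ []) (tr₂< ∷ hd< ∷ []))
    (solve 3 (λ x y z → (y :* con true) :* (z :* (x :* con true)) := x :* (y :* z)) refl
           (not (σ 0)) (σ (1 + h)) (not (σ (2 + h))))

  admissible-[tr₂]-[tr₁,hd] :
    admissible (vset (3 + h) (tr₂ h ∷ [])) (vset (3 + h) (tr₁ h ∷ hd h ∷ [])) S ≡ pinned h false false σ
  admissible-[tr₂]-[tr₁,hd] = trans (admissible-vset _ _ S (tr₂< ∷ []) (tr₁< ∷ hd< ∷ []))
    (solve 3 (λ x y z → (z :* con true) :* (y :* (x :* con true)) := x :* (y :* z)) refl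
           (not (σ 0)) (not (σ (1 + h))) (σ (2 + h)))

-- Counting colourings of the path

∑ₗ-allSubsets-suc : ∀ n (f : VSet (suc n) → ℕ) →
  ∑ₗ f (allSubsets (suc n)) ≡ ∑ₗ (f ∘ (true ∷ᵥ_)) (allSubsets n) + ∑ₗ (f ∘ (false ∷ᵥ_)) (allSubsets n)
∑ₗ-allSubsets-suc n f =
  trans (∑ₗ-++ f (map (true ∷ᵥ_) (allSubsets n)) (map (false ∷ᵥ_) (allSubsets n)))
        (cong₂ _+_ (∑ₗ-map f (true ∷ᵥ_) (allSubsets n)) (∑ₗ-map f (false ∷ᵥ_) (allSubsets n)))

pathCount : ℕ → Bool → Bool → ℕ → ℕ
pathCount h β γ k =
  ∑ₗ (λ S → ⟨ pinned h β γ ⟦ S ⟧ ⟩ * δ (h + monoPathEdges h ⟦ S ⟧) k) (allSubsets (3 + h))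

pathCount-zero : ∀ β γ k → pathCount 0 β γ k ≡ coeff oneₚ k
pathCount-zero true  true  zero    = refl
pathCount-zero true  true  (suc k) = refl
pathCount-zero true  false zero    = refl
pathCount-zero true  false (suc k) = refl
pathCount-zero false true  zero    = refl
pathCount-zero false true  (suc k) = refl
pathCount-zero false false zero    = refl
pathCount-zero false false (suc k) = refl

c*δ-two-steps : ∀ c m k → c * δ (suc (suc m)) k ≡ shift (shift (λ j → c * δ m j)) k + shift (λ _ → 0) k
c*δ-two-steps c m k = begin
    c * δ (suc (suc m)) k
  ≡⟨ c*δ-suc c (suc m) k ⟩
    shift (λ j → c * δ (suc m) j) k
  ≡⟨ shift-cong k (c*δ-suc c m) ⟩
    shift (shift (λ j → c * δ m j)) k
  ≡⟨ sym (+-identityʳ _) ⟩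
    shift (shift (λ j → c * δ m j)) k + 0
  ≡⟨ cong (shift (shift (λ j → c * δ m j)) k +_) (sym (shift-zero k (λ _ → refl))) ⟩
    shift (shift (λ j → c * δ m j)) k + shift (λ _ → 0) k ∎

c*δ-one-step : ∀ c m k → c * δ (suc m) k ≡ shift (shift (λ _ → 0)) k + shift (λ j → c * δ m j) k
c*δ-one-step c m k =
  trans (c*δ-suc c m k)
        (cong (_+ shift (λ j → c * δ m j) k) (sym (shift-zero k (λ j → shift-zero j (λ _ → refl)))))

-- hd has colour β and its path neighbour colour y.
hd-edge : ∀ h m k β y T →
  ⟨ T ⟩ * δ (suc h + (⟨ β == y ⟩ + m)) k
    ≡ shift (shift (λ j → ⟨ (y == β) ∧ T ⟩ * δ (h + m) j)) k
      + shift (λ j → ⟨ (y == not β) ∧ T ⟩ * δ (h + m) j) k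
hd-edge h m k true  true  T = trans (cong (λ e → ⟨ T ⟩ * δ (suc e) k) (+-suc h m)) (c*δ-two-steps ⟨ T ⟩ (h + m) k)
hd-edge h m k true  false T = c*δ-one-step ⟨ T ⟩ (h + m) k
hd-edge h m k false true  T = c*δ-one-step ⟨ T ⟩ (h + m) k
hd-edge h m k false false T = trans (cong (λ e → ⟨ T ⟩ * δ (suc e) k) (+-suc h m)) (c*δ-two-steps ⟨ T ⟩ (h + m) k)

pathCount-suc : ∀ h β γ k →
  pathCount (suc h) β γ k ≡ shift (shift (pathCount h β γ)) k + shift (pathCount h (not β) γ) k
pathCount-suc h β γ k = begin
    pathCount (suc h) β γ k
  ≡⟨ ∑ₗ-allSubsets-suc (3 + h) (term β) ⟩
    ∑ₗ (term β ∘ (true ∷ᵥ_)) Ss + ∑ₗ (term β ∘ (false ∷ᵥ_)) Ss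
  ≡⟨ hd-coloured β ⟩
    ∑ₗ (λ S → ⟨ trColoured h γ ⟦ S ⟧ ⟩ * δ (suc h + (⟨ β == ⟦ S ⟧ 0 ⟩ + m S)) k) Ss
  ≡⟨ ∑ₗ-cong Ss (λ { (y ∷ᵥ S) → hd-edge h (m (y ∷ᵥ S)) k β y (trColoured h γ ⟦ y ∷ᵥ S ⟧) }) ⟩
    ∑ₗ (λ S → shift (shift (F β S)) k + shift (F (not β) S) k) Ss
  ≡⟨ ∑ₗ-+ (λ S → shift (shift (F β S)) k) (λ S → shift (F (not β) S) k) Ss ⟩
    ∑ₗ (λ S → shift (shift (F β S)) k) Ss + ∑ₗ (λ S → shift (F (not β) S) k) Ss
  ≡⟨ cong₂ _+_ (trans (∑ₗ-shift (λ S → shift (F β S)) Ss k) (shift-cong k (∑ₗ-shift (F β) Ss)))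
               (∑ₗ-shift (F (not β)) Ss k) ⟩
    shift (shift (pathCount h β γ)) k + shift (pathCount h (not β) γ) k ∎
  where
  Ss = allSubsets (3 + h)
  m : VSet (3 + h) → ℕ
  m S = monoPathEdges h ⟦ S ⟧
  term : Bool → VSet (4 + h) → ℕ
  term b S = ⟨ pinned (suc h) b γ ⟦ S ⟧ ⟩ * δ (suc h + monoPathEdges (suc h) ⟦ S ⟧) k
  F : Bool → VSet (3 + h) → ℕ → ℕ
  F b S j = ⟨ pinned h b γ ⟦ S ⟧ ⟩ * δ (h + m S) j
  hd-coloured : ∀ b → ∑ₗ (term b ∘ (true ∷ᵥ_)) Ss + ∑ₗ (term b ∘ (false ∷ᵥ_)) Ss
    ≡ ∑ₗ (λ S → ⟨ trColoured h γ ⟦ S ⟧ ⟩ * δ (suc h + (⟨ b == ⟦ S ⟧ 0 ⟩ + m S)) k) Ss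
  hd-coloured true  = trans (cong (∑ₗ (term true ∘ (true ∷ᵥ_)) Ss +_) (∑ₗ-zero Ss)) (+-identityʳ _)
  hd-coloured false = cong (_+ ∑ₗ (term false ∘ (false ∷ᵥ_)) Ss) (∑ₗ-zero Ss)

pathCount≡coeff : ∀ h β γ k → pathCount h β γ k ≡ coeff ((tₚ *ₚ tₚ +ₚ tₚ) ^ₚ h) k
pathCount≡coeff zero    β γ k = pathCount-zero β γ k
pathCount≡coeff (suc h) β γ k = begin
    pathCount (suc h) β γ k
  ≡⟨ pathCount-suc h β γ k ⟩
    shift (shift (pathCount h β γ)) k + shift (pathCount h (not β) γ) k
  ≡⟨ cong₂ _+_ (shift-cong k (λ j → shift-cong j (pathCount≡coeff h β γ)))
               (shift-cong k (pathCount≡coeff h (not β) γ)) ⟩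
    shift (shift (coeff P)) k + shift (coeff P) k
  ≡⟨ sym (coeff-[t²+t]*ₚ P k) ⟩
    coeff ((tₚ *ₚ tₚ +ₚ tₚ) *ₚ P) k ∎
  where
  P = (tₚ *ₚ tₚ +ₚ tₚ) ^ₚ h

Z-pinned : ∀ h β γ xs ys →
  (∀ S → admissible (vset (3 + h) xs) (vset (3 + h) ys) S ≡ pinned h β γ ⟦ S ⟧) →
  Z (graphOn (3 + h) (adjℕ h)) (vset (3 + h) xs) (vset (3 + h) ys) 1 ≈ₚ rhs h
Z-pinned h β γ xs ys adm≡pinned k = begin
    coeff (Z G B C 1) k
  ≡⟨ coeff-foldr-+ₚ term Ss k ⟩
    ∑ₗ (λ S → coeff (term S) k) Ss
  ≡⟨ ∑ₗ-cong Ss coeff-term ⟩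
    ∑ₗ (λ S → shift (F S) k) Ss
  ≡⟨ ∑ₗ-shift F Ss k ⟩
    shift (pathCount h β γ) k
  ≡⟨ shift-cong k (pathCount≡coeff h β γ) ⟩
    shift (coeff ((tₚ *ₚ tₚ +ₚ tₚ) ^ₚ h)) k
  ≡⟨ sym (coeff-tₚ*ₚ ((tₚ *ₚ tₚ +ₚ tₚ) ^ₚ h) k) ⟩
    coeff (rhs h) k ∎
  where
  G = graphOn (3 + h) (adjℕ h)
  B = vset (3 + h) xs
  C = vset (3 + h) ys
  Ss = allSubsets (3 + h)
  term : VSet (3 + h) → Poly
  term S = if admissible B C S then monomial (1 ^ size S) (edgesIn G S + edgesOut G S) else []
  F : VSet (3 + h) → ℕ → ℕ
  F S j = ⟨ pinned h β γ ⟦ S ⟧ ⟩ * δ (h + monoPathEdges h ⟦ S ⟧) j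
  coeff-term : ∀ S → coeff (term S) k ≡ shift (F S) k
  coeff-term S rewrite adm≡pinned S with pinned h β γ ⟦ S ⟧ in eq
  ... | false = sym (shift-zero k (λ _ → refl))
  ... | true  = begin
      coeff (monomial (1 ^ size S) (edgesIn G S + edgesOut G S)) k
    ≡⟨ coeff-monomial (1 ^ size S) (edgesIn G S + edgesOut G S) k ⟩
      1 ^ size S * δ (edgesIn G S + edgesOut G S) k
    ≡⟨ cong₂ (λ c e → c * δ e k) (^-zeroˡ (size S)) (L-monochromatic-edges h S tr₂-opposite) ⟩
      1 * δ (suc h + monoPathEdges h ⟦ S ⟧) k
    ≡⟨ c*δ-suc 1 (h + monoPathEdges h ⟦ S ⟧) k ⟩
      shift (λ j → 1 * δ (h + monoPathEdges h ⟦ S ⟧) j) k ∎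
    where
    tr₂-opposite : ⟦ S ⟧ (2 + h) ≡ not (⟦ S ⟧ (1 + h))
    tr₂-opposite = trColoured-opposite γ _ _ (∧-conicalʳ (⟦ S ⟧ 0 == β) _ eq)

BoundaryIdentities : ℕ → ℕ → Set
BoundaryIdentities h n =
      (Z (graphOn n (adjℕ h)) (vset n (tr₁ h ∷ hd h ∷ [])) (vset n (tr₂ h ∷ [])) 1 ≈ₚ rhs h)
    × (Z (graphOn n (adjℕ h)) (vset n (tr₂ h ∷ hd h ∷ [])) (vset n (tr₁ h ∷ [])) 1 ≈ₚ rhs h)
    × (Z (graphOn n (adjℕ h)) (vset n (tr₁ h ∷ [])) (vset n (tr₂ h ∷ hd h ∷ [])) 1 ≈ₚ rhs h)
    × (Z (graphOn n (adjℕ h)) (vset n (tr₂ h ∷ [])) (vset n (tr₁ h ∷ hd h ∷ [])) 1 ≈ₚ rhs h)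

mainTheorem6 : (h : ℕ) →
      (Z (L h) (vset (h + 3) (tr₁ h ∷ hd h ∷ [])) (vset (h + 3) (tr₂ h ∷ [])) 1 ≈ₚ rhs h)
    × (Z (L h) (vset (h + 3) (tr₂ h ∷ hd h ∷ [])) (vset (h + 3) (tr₁ h ∷ [])) 1 ≈ₚ rhs h)
    × (Z (L h) (vset (h + 3) (tr₁ h ∷ [])) (vset (h + 3) (tr₂ h ∷ hd h ∷ [])) 1 ≈ₚ rhs h)
    × (Z (L h) (vset (h + 3) (tr₂ h ∷ [])) (vset (h + 3) (tr₁ h ∷ hd h ∷ [])) 1 ≈ₚ rhs h)
mainTheorem6 h = subst (BoundaryIdentities h) (+-comm 3 h)
  ( Z-pinned h true  true  (tr₁ h ∷ hd h ∷ []) (tr₂ h ∷ []) (admissible-[tr₁,hd]-[tr₂] h)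
  , Z-pinned h true  false (tr₂ h ∷ hd h ∷ []) (tr₁ h ∷ []) (admissible-[tr₂,hd]-[tr₁] h)
  , Z-pinned h false true  (tr₁ h ∷ []) (tr₂ h ∷ hd h ∷ []) (admissible-[tr₁]-[tr₂,hd] h)
  , Z-pinned h false false (tr₂ h ∷ []) (tr₁ h ∷ hd h ∷ []) (admissible-[tr₂]-[tr₁,hd] h) )
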